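{- Let $n\ge 3$. Every ordering $\mathcal A \in \mathcal S_n$ of the matrix chain $M_1 M_2\cdots M_n$ is uniquely optimal on infinitely many instances $\boldsymbol k=(k_0,\ldots,k_n)$ of positive integers.
   Context: A matrix chain of length $n$ is a product $M_1 M_2 \cdots M_n$ where $M_i$ has size $k_{i-1}\times k_i$; an instance is a tuple $\boldsymbol k=(k_0,k_1,\ldots,k_n)$ of positive integers. $\mathcal S_n$ denotes the set of all (full) parenthesisations of $M_1\cdots M_n$ (there are $C_{n-1}$ of them); each parenthesisation is called an ordering. Each of the $n-1$ multiplications in an ordering multiplies a subproduct $(M_{a+1}\cdots M_b)$ by $(M_{b+1}\cdots M_c)$ for some $0\le a<b<c\le n$ and has cost $k_a k_b k_c$. The cost $T(\mathcal A,\boldsymbol k)$ of ordering $\mathcal A$ on instance $\boldsymbol k$ is the sum of the costs of its $n-1$ multiplications. An ordering $\mathcal A$ is uniquely optimal on $\boldsymbol k$ if $T(\mathcal A,\boldsymbol k) < T(\mathcal B,\boldsymbol k)$ for every $\mathcal B\in\mathcal S_n\setminus\{\mathcal A\}$. -}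

module Defs where

open import Data.Nat using (ℕ; zero; suc; _+_; _*_; _<_)
open import Data.Fin using (Fin; fromℕ<)
open import Data.Vec using (Vec; lookup)
open import Data.Vec.Relation.Unary.All using (All)
open import Relation.Binary.PropositionalEquality using (_≡_; _≢_)
open import Relation.Nullary using (Dec; yes; no)
open import Data.Nat.Properties using (_<?_)

-- A full parenthesisation of a chain of m matrices (m ≥ 1):
-- a full binary tree with m leaves.  The ordering set S_n is  Ordering n.
data Ordering : ℕ → Set where
  leaf : Ordering 1
  node : ∀ {m p} → Ordering m → Ordering p → Ordering (m + p)

-- Instance k = (k_0 , … , k_n) as a vector of length n+1;  dimension lookup
-- (out-of-range indices never occur for well-formed orderings; default 0).
dim : ∀ {n} → Vec ℕ (suc n) → ℕ → ℕ
dim {n} k i with i <? suc n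
... | yes i<n = lookup k (fromℕ< i<n)
... | no _    = 0

-- Cost of a parenthesisation of the subchain M_{a+1} ⋯ M_{a+m}:
-- a node splitting M_{a+1}⋯M_{a+m} ⋅ M_{a+m+1}⋯M_{a+m+p} costs k_a k_{a+m} k_{a+m+p}.
costFrom : ∀ {n m} → Vec ℕ (suc n) → ℕ → Ordering m → ℕ
costFrom k a leaf = 0
costFrom k a (node {m} {p} l r) =
  costFrom k a l + costFrom k (a + m) r + dim k a * dim k (a + m) * dim k (a + m + p)

T : ∀ {n} → Ordering n → Vec ℕ (suc n) → ℕ
T A k = costFrom k 0 A

UniquelyOptimal : ∀ {n} → Ordering n → Vec ℕ (suc n) → Set
UniquelyOptimal {n} A k = (B : Ordering n) → B ≢ A → T A k < T B k

Positive : ∀ {n} → Vec ℕ n → Set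
Positive k = All (λ x → 0 < x) k

-- Write the dimensions as k_i = N + δ_i.  Expanding (N + δ_a)(N + δ_b)(N + δ_c), the cost of an
-- ordering of n matrices is (n - 1) N³ + N² S + (N S₂ + S₃), where S is the additive cost, the sum
-- of δ_a + δ_b + δ_c over its multiplications.  So once N exceeds S₂ + S₃ of an ordering that is
-- the unique minimiser of S, that ordering is uniquely optimal, and N can be taken arbitrarily large.
--
-- Every ordering uniquely minimises some additive cost, by induction on n.  An ordering multiplies
-- some M_{x+1} M_{x+2} directly; contracting that product to one matrix leaves an ordering of
-- n - 1 matrices, the unique minimiser for some δ.  Insert at the new boundary x + 1 a weight c
-- exceeding its additive cost plus δ_x + δ_{x+1}.  An ordering that multiplies M_{x+1} M_{x+2}
-- directly costs δ_x + c + δ_{x+1} more than its contraction; any other ordering has the boundary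
-- x + 1 in at least two of its multiplications, so it costs at least 2c.

module Submission where

open import Data.Nat using (ℕ; zero; suc; _+_; _*_; _≤_; _<_; z≤n; s≤s)
open import Data.Nat.Properties
open import Data.Nat.Tactic.RingSolver using (solve-∀)
open import Data.Product using (Σ; ∃; ∃₂; _×_; _,_; proj₁; proj₂)
import Data.Product as Product
open import Data.Sum using (_⊎_; inj₁; inj₂)
import Data.Sum as Sum
open import Data.Empty using (⊥-elim)
open import Function using (_∘_)
open import Relation.Binary.Definitions using (tri<; tri≈; tri>)
open import Relation.Binary.PropositionalEquality
open import Data.Fin using (toℕ; fromℕ<)
open import Data.Fin.Properties using (toℕ-fromℕ<)
open import Data.Vec using (Vec; tabulate; head)
open import Data.Vec.Properties using (lookup∘tabulate)
open import Data.Vec.Relation.Unary.All.Properties using (tabulate⁺)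
open import Function.Definitions using (Injective)
open import Relation.Nullary using (yes; no)
open import Defs

cong₃ : ∀ {A B C D : Set} (f : A → B → C → D) {x x′ y y′ z z′} →
        x ≡ x′ → y ≡ y′ → z ≡ z′ → f x y z ≡ f x′ y′ z′
cong₃ f refl refl refl = refl

-- Orderings as unindexed trees, so that splitting a leaf needs no transport along m + suc p ≡ suc (m + p).
data Tree : Set where
  tip : Tree
  bin : Tree → Tree → Tree

bin-injective : ∀ {l r l′ r′} → bin l r ≡ bin l′ r′ → l ≡ l′ × r ≡ r′
bin-injective refl = refl , refl

size : Tree → ℕ
size tip       = 1
size (bin l r) = size l + size r

0<size : ∀ t → 0 < size t
0<size tip       = s≤s z≤n
0<size (bin l r) = ≤-trans (0<size l) (m≤m+n (size l) (size r))

2≤size-bin : ∀ l r → 2 ≤ size (bin l r)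
2≤size-bin l r = +-mono-≤ (0<size l) (0<size r)

internalNodes : Tree → ℕ
internalNodes tip       = 0
internalNodes (bin l r) = internalNodes l + internalNodes r + 1

internalNodes+1≡size : ∀ t → internalNodes t + 1 ≡ size t
internalNodes+1≡size tip       = refl
internalNodes+1≡size (bin l r) = begin
  internalNodes l + internalNodes r + 1 + 1     ≡⟨ regroup (internalNodes l) (internalNodes r) ⟩
  (internalNodes l + 1) + (internalNodes r + 1) ≡⟨ cong₂ _+_ (internalNodes+1≡size l) (internalNodes+1≡size r) ⟩
  size l + size r                               ∎
  where
  open ≡-Reasoning
  regroup : ∀ a b → a + b + 1 + 1 ≡ (a + 1) + (b + 1)
  regroup = solve-∀

size⇒internalNodes : ∀ s t → size s ≡ size t → internalNodes s ≡ internalNodes t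
size⇒internalNodes s t size≡ = +-cancelʳ-≡ 1 _ _
  (trans (internalNodes+1≡size s) (trans size≡ (sym (internalNodes+1≡size t))))

cost : (ℕ → ℕ → ℕ → ℕ) → (ℕ → ℕ) → Tree → ℕ
cost g w tip       = 0
cost g w (bin l r) = cost g w l + cost g (w ∘ (size l +_)) r + g (w 0) (w (size l)) (w (size l + size r))

cost-cong : ∀ g {w w′} t → (∀ i → i ≤ size t → w i ≡ w′ i) → cost g w t ≡ cost g w′ t
cost-cong g tip       w≡w′ = refl
cost-cong g (bin l r) w≡w′ = cong₂ _+_
  (cong₂ _+_ (cost-cong g l λ i i≤ → w≡w′ i (≤-trans i≤ (m≤m+n (size l) (size r))))
             (cost-cong g r λ i i≤ → w≡w′ (size l + i) (+-monoʳ-≤ (size l) i≤)))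
  (cong₃ g (w≡w′ 0 z≤n) (w≡w′ (size l) (m≤m+n (size l) (size r))) (w≡w′ (size l + size r) ≤-refl))

e₁ e₂ e₃ : ℕ → ℕ → ℕ → ℕ
e₁ x y z = x + y + z
e₂ x y z = x * y + x * z + y * z
e₃ x y z = x * y * z

-- SplitLeaf x t₀ t: t is t₀ with its leaf number x (from 0) replaced by a cherry, which creates
-- the new boundary x + 1.
data SplitLeaf : ℕ → Tree → Tree → Set where
  here  : SplitLeaf 0 tip (bin tip tip)
  left  : ∀ {x l₀ l} r → SplitLeaf x l₀ l → SplitLeaf x (bin l₀ r) (bin l r)
  right : ∀ {x r₀ r} l → SplitLeaf x r₀ r → SplitLeaf (size l + x) (bin l r₀) (bin l r)

splitLeaf-size : ∀ {x t₀ t} → SplitLeaf x t₀ t → size t ≡ suc (size t₀)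
splitLeaf-size here                  = refl
splitLeaf-size (left r p)            = cong (_+ size r) (splitLeaf-size p)
splitLeaf-size (right {r₀ = r₀} l p) = trans (cong (size l +_) (splitLeaf-size p)) (+-suc (size l) (size r₀))

splitLeaf-< : ∀ {x t₀ t} → SplitLeaf x t₀ t → x < size t₀
splitLeaf-< here                 = s≤s z≤n
splitLeaf-< (left {l₀ = l₀} r p) = ≤-trans (splitLeaf-< p) (m≤m+n (size l₀) (size r))
splitLeaf-< (right l p)          = +-monoʳ-< (size l) (splitLeaf-< p)

splitLeaf-functional : ∀ {x x′ t₀ t t′} → SplitLeaf x t₀ t → SplitLeaf x′ t₀ t′ → x ≡ x′ → t ≡ t′
splitLeaf-functional here        here         _ = refl
splitLeaf-functional (left r p)  (left _ q)   e = cong (λ l → bin l r) (splitLeaf-functional p q e)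
splitLeaf-functional (right l p) (right _ q)  e = cong (bin l) (splitLeaf-functional p q (+-cancelˡ-≡ (size l) _ _ e))
splitLeaf-functional (left r p)  (right l₀ q) e = ⊥-elim (<⇒≱ (splitLeaf-< p) (subst (size l₀ ≤_) (sym e) (m≤m+n _ _)))
splitLeaf-functional (right l p) (left _ q)   e = ⊥-elim (<⇒≱ (splitLeaf-< q) (subst (size l ≤_) e (m≤m+n _ _)))

splitLeaf-exists : ∀ l r → ∃₂ λ x t₀ → SplitLeaf x t₀ (bin l r)
splitLeaf-exists tip         tip         = 0 , tip , here
splitLeaf-exists tip         (bin r₁ r₂) with splitLeaf-exists r₁ r₂
... | x , r₀ , p = 1 + x , bin tip r₀ , right tip p
splitLeaf-exists (bin l₁ l₂) r           with splitLeaf-exists l₁ l₂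
... | x , l₀ , p = x , bin l₀ r , left r p

insertAt : ℕ → ℕ → (ℕ → ℕ) → ℕ → ℕ
insertAt zero    c δ zero    = c
insertAt zero    c δ (suc v) = δ v
insertAt (suc y) c δ zero    = δ zero
insertAt (suc y) c δ (suc v) = insertAt y c (δ ∘ suc) v

insertAt-< : ∀ {y v} c δ → v < y → insertAt y c δ v ≡ δ v
insertAt-< {suc y} {zero}  c δ _         = refl
insertAt-< {suc y} {suc v} c δ (s≤s v<y) = insertAt-< c (δ ∘ suc) v<y

insertAt-≡ : ∀ y c δ → insertAt y c δ y ≡ c
insertAt-≡ zero    c δ = refl
insertAt-≡ (suc y) c δ = insertAt-≡ y c (δ ∘ suc)

insertAt-> : ∀ {y v} c δ → y ≤ v → insertAt y c δ (suc v) ≡ δ v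
insertAt-> {zero}          c δ _         = refl
insertAt-> {suc y} {suc v} c δ (s≤s y≤v) = insertAt-> c (δ ∘ suc) y≤v

insertAt-shift : ∀ s {x} c δ i → insertAt (suc (s + x)) c δ (s + i) ≡ insertAt (suc x) c (δ ∘ (s +_)) i
insertAt-shift zero    c δ i = refl
insertAt-shift (suc s) c δ i = insertAt-shift s c (δ ∘ suc) i

cost-e₁-splitLeaf : ∀ {x t₀ t} c δ → SplitLeaf x t₀ t →
  cost e₁ (insertAt (suc x) c δ) t ≡ cost e₁ δ t₀ + e₁ (δ x) c (δ (suc x))
cost-e₁-splitLeaf c δ here = refl
cost-e₁-splitLeaf {x} c δ (left {l₀ = l₀} {l} r p) rewrite splitLeaf-size p = begin
  cost e₁ δ′ l + cost e₁ (δ′ ∘ (suc (size l₀) +_)) r + e₁ (δ 0) (δ′ (suc (size l₀))) (δ′ (suc (size l₀ + size r)))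
    ≡⟨ cong₃ (λ a b m → a + b + m) (cost-e₁-splitLeaf c δ p)
             (cost-cong e₁ r λ i _ → above (m≤m+n (size l₀) i))
             (cong₂ (e₁ (δ 0)) (above ≤-refl) (above (m≤m+n (size l₀) (size r)))) ⟩
  cost e₁ δ l₀ + C + cost e₁ (δ ∘ (size l₀ +_)) r + e₁ (δ 0) (δ (size l₀)) (δ (size l₀ + size r))
    ≡⟨ move-last (cost e₁ δ l₀) C _ _ ⟩
  cost e₁ δ l₀ + cost e₁ (δ ∘ (size l₀ +_)) r + e₁ (δ 0) (δ (size l₀)) (δ (size l₀ + size r)) + C
    ∎
  where
  open ≡-Reasoning
  δ′ : ℕ → ℕ
  δ′ = insertAt (suc x) c δ
  C : ℕ
  C = e₁ (δ x) c (δ (suc x))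
  above : ∀ {v} → size l₀ ≤ v → δ′ (suc v) ≡ δ v
  above l₀≤v = insertAt-> c δ (≤-trans (splitLeaf-< p) l₀≤v)
  move-last : ∀ a b d e → a + b + d + e ≡ a + d + e + b
  move-last = solve-∀
cost-e₁-splitLeaf c δ (right {x} {r₀} {r} l p) rewrite splitLeaf-size p = begin
  cost e₁ δ′ l + cost e₁ (δ′ ∘ (size l +_)) r + e₁ (δ 0) (δ′ (size l)) (δ′ (size l + suc (size r₀)))
    ≡⟨ cong₃ (λ a b m → a + b + m)
             (cost-cong e₁ l λ i i≤l → below (s≤s (≤-trans i≤l (m≤m+n (size l) x))))
             (trans (cost-cong e₁ r λ i _ → insertAt-shift (size l) c δ i) (cost-e₁-splitLeaf c (δ ∘ (size l +_)) p))
             (cong₂ (e₁ (δ 0)) (below (s≤s (m≤m+n (size l) x)))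
                               (trans (cong δ′ (+-suc (size l) (size r₀))) (insertAt-> c δ (+-monoʳ-< (size l) (splitLeaf-< p))))) ⟩
  cost e₁ δ l + (cost e₁ (δ ∘ (size l +_)) r₀ + e₁ (δ (size l + x)) c (δ (size l + suc x))) + E
    ≡⟨ cong (λ v → cost e₁ δ l + (cost e₁ (δ ∘ (size l +_)) r₀ + e₁ (δ (size l + x)) c (δ v)) + E) (+-suc (size l) x) ⟩
  cost e₁ δ l + (cost e₁ (δ ∘ (size l +_)) r₀ + C) + E
    ≡⟨ move-last (cost e₁ δ l) _ C E ⟩
  cost e₁ δ l + cost e₁ (δ ∘ (size l +_)) r₀ + E + C
    ∎
  where
  open ≡-Reasoning
  δ′ : ℕ → ℕ
  δ′ = insertAt (suc (size l + x)) c δ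
  C E : ℕ
  C = e₁ (δ (size l + x)) c (δ (suc (size l + x)))
  E = e₁ (δ 0) (δ (size l)) (δ (size l + size r₀))
  below : ∀ {v} → v < suc (size l + x) → δ′ v ≡ δ v
  below = insertAt-< c δ
  move-last : ∀ a b d e → a + (b + d) + e ≡ a + b + e + d
  move-last = solve-∀

node≤cost : ∀ g w l r → g (w 0) (w (size l)) (w (size l + size r)) ≤ cost g w (bin l r)
node≤cost g w l r = m≤n+m _ (cost g w l + cost g (w ∘ (size l +_)) r)

left≤cost : ∀ g w l r → cost g w l ≤ cost g w (bin l r)
left≤cost g w l r = ≤-trans (m≤m+n (cost g w l) (cost g (w ∘ (size l +_)) r)) (m≤m+n _ _)

right≤cost : ∀ g w l r → cost g (w ∘ (size l +_)) r ≤ cost g w (bin l r)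
right≤cost g w l r = ≤-trans (m≤n+m (cost g (w ∘ (size l +_)) r) (cost g w l)) (m≤m+n _ _)

first≤e₁-cost : ∀ δ l r → δ 0 ≤ cost e₁ δ (bin l r)
first≤e₁-cost δ l r = ≤-trans (≤-trans (m≤m+n (δ 0) (δ (size l))) (m≤m+n _ _)) (node≤cost e₁ δ l r)

last≤e₁-cost : ∀ δ l r → δ (size (bin l r)) ≤ cost e₁ δ (bin l r)
last≤e₁-cost δ l r = ≤-trans (m≤n+m _ (δ 0 + δ (size l))) (node≤cost e₁ δ l r)

middle≤e₁-node : ∀ x y z → y ≤ e₁ x y z
middle≤e₁-node x y z = ≤-trans (m≤n+m y x) (m≤m+n _ z)

splitLeaf⊎heavy-root : ∀ δ l r x → suc x ≡ size l →
  (∃ λ t₀ → SplitLeaf x t₀ (bin l r)) ⊎ (δ (suc x) + δ (suc x) ≤ cost e₁ δ (bin l r))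
splitLeaf⊎heavy-root δ tip tip         .0 refl = inj₁ (tip , here)
splitLeaf⊎heavy-root δ tip (bin r₁ r₂) .0 refl =
  inj₂ (+-mono-≤ (first≤e₁-cost (δ ∘ suc) r₁ r₂) (middle≤e₁-node (δ 0) (δ 1) (δ (1 + size (bin r₁ r₂)))))
splitLeaf⊎heavy-root δ (bin l₁ l₂) r x sx≡l rewrite sx≡l =
  inj₂ (≤-trans (+-mono-≤ (last≤e₁-cost δ l₁ l₂) (middle≤e₁-node (δ 0) (δ (size l)) (δ (size l + size r))))
                (+-monoˡ-≤ _ (m≤m+n (cost e₁ δ l) (cost e₁ (δ ∘ (size l +_)) r))))
  where
  l : Tree
  l = bin l₁ l₂

splitLeaf⊎heavy : ∀ δ t x → suc x < size t →
  (∃ λ t₀ → SplitLeaf x t₀ t) ⊎ (δ (suc x) + δ (suc x) ≤ cost e₁ δ t)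
splitLeaf⊎heavy δ tip       x (s≤s ())
splitLeaf⊎heavy δ (bin l r) x sx<t with <-cmp (suc x) (size l)
... | tri< sx<l _ _ = Sum.map (Product.map (λ l₀ → bin l₀ r) (left r))
                              (λ heavy → ≤-trans heavy (left≤cost e₁ δ l r))
                              (splitLeaf⊎heavy δ l x sx<l)
... | tri≈ _ sx≡l _ = splitLeaf⊎heavy-root δ l r x sx≡l
... | tri> _ _ l<sx with m≤n⇒∃[o]m+o≡n (≤-pred l<sx)
...   | x′ , refl = Sum.map (Product.map (bin l) (right l))
                            (λ heavy → ≤-trans (subst (λ v → δ v + δ v ≤ cost e₁ (δ ∘ (size l +_)) r) (+-suc (size l) x′) heavy)
                                               (right≤cost e₁ δ l r))
                            (splitLeaf⊎heavy (δ ∘ (size l +_)) r x′ sx′<r)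
  where
  sx′<r : suc x′ < size r
  sx′<r = +-cancelˡ-< (size l) _ _ (subst (_< size l + size r) (sym (+-suc (size l) x′)) sx<t)

UniqueMinimiser : (ℕ → ℕ) → Tree → Set
UniqueMinimiser δ t = ∀ t′ → size t′ ≡ size t → t′ ≢ t → cost e₁ δ t < cost e₁ δ t′

tip-uniqueMinimiser : ∀ δ → UniqueMinimiser δ tip
tip-uniqueMinimiser δ tip       _      t′≢tip = ⊥-elim (t′≢tip refl)
tip-uniqueMinimiser δ (bin l r) size≡1 _      = ⊥-elim (<⇒≱ (2≤size-bin l r) (≤-reflexive size≡1))

splitLeaf-uniqueMinimiser : ∀ {x t₀ t δ} c → cost e₁ δ t₀ + δ x + δ (suc x) < c →
  SplitLeaf x t₀ t → UniqueMinimiser δ t₀ → UniqueMinimiser (insertAt (suc x) c δ) t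
splitLeaf-uniqueMinimiser {x} {t₀} {t} {δ} c heavy p minimal t′ size≡ t′≢t =
  compare (splitLeaf⊎heavy δ′ t′ x (subst (suc x <_) (sym (trans size≡ (splitLeaf-size p))) (s≤s (splitLeaf-< p))))
  where
  open ≤-Reasoning
  δ′ : ℕ → ℕ
  δ′ = insertAt (suc x) c δ
  C : ℕ
  C = e₁ (δ x) c (δ (suc x))

  compare : (∃ λ t₀′ → SplitLeaf x t₀′ t′) ⊎ (δ′ (suc x) + δ′ (suc x) ≤ cost e₁ δ′ t′) →
            cost e₁ δ′ t < cost e₁ δ′ t′
  compare (inj₁ (t₀′ , p′)) = begin-strict
    cost e₁ δ′ t      ≡⟨ cost-e₁-splitLeaf c δ p ⟩
    cost e₁ δ t₀ + C  <⟨ +-monoˡ-< C (minimal t₀′ size₀≡ t₀′≢t₀) ⟩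
    cost e₁ δ t₀′ + C ≡⟨ cost-e₁-splitLeaf c δ p′ ⟨
    cost e₁ δ′ t′     ∎
    where
    size₀≡ : size t₀′ ≡ size t₀
    size₀≡ = suc-injective (trans (sym (splitLeaf-size p′)) (trans size≡ (splitLeaf-size p)))
    t₀′≢t₀ : t₀′ ≢ t₀
    t₀′≢t₀ refl = t′≢t (splitLeaf-functional p′ p refl)
  compare (inj₂ double) = begin-strict
    cost e₁ δ′ t                         ≡⟨ cost-e₁-splitLeaf c δ p ⟩
    cost e₁ δ t₀ + C                     ≡⟨ regroup (cost e₁ δ t₀) (δ x) c (δ (suc x)) ⟩
    cost e₁ δ t₀ + δ x + δ (suc x) + c   <⟨ +-monoˡ-< c heavy ⟩
    c + c                                ≡⟨ cong₂ _+_ spike spike ⟨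
    δ′ (suc x) + δ′ (suc x)              ≤⟨ double ⟩
    cost e₁ δ′ t′                        ∎
    where
    spike : δ′ (suc x) ≡ c
    spike = insertAt-≡ (suc x) c δ
    regroup : ∀ a u c v → a + (u + c + v) ≡ a + u + v + c
    regroup = solve-∀

uniqueMinimiser-of-size : ∀ n t → size t ≡ suc n → ∃ λ δ → UniqueMinimiser δ t
uniqueMinimiser-of-size _       tip       _      = (λ _ → 0) , tip-uniqueMinimiser _
uniqueMinimiser-of-size zero    (bin l r) size≡1 = ⊥-elim (<⇒≱ (2≤size-bin l r) (≤-reflexive size≡1))
uniqueMinimiser-of-size (suc n) (bin l r) size≡ with splitLeaf-exists l r
... | x , t₀ , p with uniqueMinimiser-of-size n t₀ (suc-injective (trans (sym (splitLeaf-size p)) size≡))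
...   | δ , minimal = insertAt (suc x) c δ , splitLeaf-uniqueMinimiser c (n<1+n _) p minimal
  where
  c : ℕ
  c = suc (cost e₁ δ t₀ + δ x + δ (suc x))

uniqueMinimiser : ∀ t → ∃ λ δ → UniqueMinimiser δ t
uniqueMinimiser t with m≤n⇒∃[o]m+o≡n (0<size t)
... | n , size≡ = uniqueMinimiser-of-size n t (sym size≡)

cost-e₃-offset : ∀ N δ t → cost e₃ (λ i → N + δ i) t ≡
  internalNodes t * (N * N * N) + N * N * cost e₁ δ t + (N * cost e₂ δ t + cost e₃ δ t)
cost-e₃-offset N δ tip = tip-expansion N
  where
  tip-expansion : ∀ N → 0 ≡ 0 * (N * N * N) + N * N * 0 + (N * 0 + 0)
  tip-expansion = solve-∀
cost-e₃-offset N δ (bin l r) =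
  trans (cong₂ (λ a b → a + b + e₃ (N + δ 0) (N + δ (size l)) (N + δ (size l + size r)))
               (cost-e₃-offset N δ l) (cost-e₃-offset N (δ ∘ (size l +_)) r))
        (node-expansion N (internalNodes l) (internalNodes r) _ _ _ _ _ _ (δ 0) (δ (size l)) (δ (size l + size r)))
  where
  node-expansion : ∀ N i j a₁ b₁ a₂ b₂ a₃ b₃ x y z →
    i * (N * N * N) + N * N * a₁ + (N * a₂ + a₃) + (j * (N * N * N) + N * N * b₁ + (N * b₂ + b₃))
      + (N + x) * (N + y) * (N + z)
    ≡ (i + j + 1) * (N * N * N) + N * N * (a₁ + b₁ + (x + y + z))
      + (N * (a₂ + b₂ + (x * y + x * z + y * z)) + (a₃ + b₃ + x * y * z))
  node-expansion = solve-∀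

N*q+s<N*N : ∀ N q s → q + s < N → N * q + s < N * N
N*q+s<N*N N@(suc _) q s q+s<N = begin-strict
  N * q + s       ≤⟨ +-monoʳ-≤ (N * q) (m≤n*m s N) ⟩
  N * q + N * s   ≡⟨ *-distribˡ-+ N q s ⟨
  N * (q + s)     <⟨ *-monoʳ-< N q+s<N ⟩
  N * N           ∎
  where open ≤-Reasoning

leading-< : ∀ X M p p′ r r′ → p < p′ → r < M → X + M * p + r < X + M * p′ + r′
leading-< X M p p′ r r′ p<p′ r<M = begin-strict
  X + M * p + r     <⟨ +-monoʳ-< (X + M * p) r<M ⟩
  X + M * p + M     ≡⟨ absorb X M p ⟩
  X + M * suc p     ≤⟨ +-monoʳ-≤ X (*-monoʳ-≤ M p<p′) ⟩
  X + M * p′        ≤⟨ m≤m+n (X + M * p′) r′ ⟩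
  X + M * p′ + r′   ∎
  where
  open ≤-Reasoning
  absorb : ∀ X M p → X + M * p + M ≡ X + M * suc p
  absorb = solve-∀

offset-uniqueOptimal : ∀ {δ t} N → UniqueMinimiser δ t → cost e₂ δ t + cost e₃ δ t < N →
  ∀ t′ → size t′ ≡ size t → t′ ≢ t → cost e₃ (λ i → N + δ i) t < cost e₃ (λ i → N + δ i) t′
offset-uniqueOptimal {δ} {t} N minimal small t′ size≡ t′≢t
  rewrite cost-e₃-offset N δ t | cost-e₃-offset N δ t′ | size⇒internalNodes t′ t size≡ =
  leading-< (internalNodes t * (N * N * N)) (N * N) _ _ _ _
            (minimal t′ size≡ t′≢t) (N*q+s<N*N N _ _ small)

toTree : ∀ {m} → Ordering m → Tree
toTree leaf       = tip
toTree (node l r) = bin (toTree l) (toTree r)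

size-toTree : ∀ {m} (A : Ordering m) → size (toTree A) ≡ m
size-toTree leaf       = refl
size-toTree (node l r) = cong₂ _+_ (size-toTree l) (size-toTree r)

toTree-injectiveΣ : ∀ {m m′} (A : Ordering m) (B : Ordering m′) →
  toTree A ≡ toTree B → _≡_ {A = Σ ℕ Ordering} (m , A) (m′ , B)
toTree-injectiveΣ leaf       leaf         refl = refl
toTree-injectiveΣ (node l r) (node l′ r′) e
  with toTree-injectiveΣ l l′ (proj₁ (bin-injective e)) | toTree-injectiveΣ r r′ (proj₂ (bin-injective e))
... | refl | refl = refl

toTree-injective : ∀ {m} (A B : Ordering m) → toTree A ≡ toTree B → A ≡ B
toTree-injective A B e with toTree-injectiveΣ A B e
... | refl = refl

costFrom-toTree : ∀ {n m} (k : Vec ℕ (suc n)) a (A : Ordering m) →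
  costFrom k a A ≡ cost e₃ (λ i → dim k (a + i)) (toTree A)
costFrom-toTree k a leaf = refl
costFrom-toTree k a (node {m} {p} l r) rewrite size-toTree l | size-toTree r =
  cong₃ (λ u v w → u + v + w)
    (costFrom-toTree k a l)
    (trans (costFrom-toTree k (a + m) r) (cost-cong e₃ (toTree r) λ i _ → cong (dim k) (+-assoc a m i)))
    (cong₃ e₃ (cong (dim k) (sym (+-identityʳ a))) refl (cong (dim k) (+-assoc a m p)))

dim-tabulate : ∀ {n} (w : ℕ → ℕ) i → i < suc n → dim {n} (tabulate (w ∘ toℕ)) i ≡ w i
dim-tabulate {n} w i i<n with i <? suc n
... | yes i<n′ = trans (lookup∘tabulate (w ∘ toℕ) (fromℕ< i<n′)) (cong w (toℕ-fromℕ< i<n′))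
... | no  i≮n  = ⊥-elim (i≮n i<n)

T-tabulate : ∀ {n} (w : ℕ → ℕ) (A : Ordering n) → T A (tabulate (w ∘ toℕ)) ≡ cost e₃ w (toTree A)
T-tabulate w A = trans (costFrom-toTree _ 0 A)
  (cost-cong e₃ (toTree A) λ i i≤ → dim-tabulate w i (s≤s (subst (i ≤_) (size-toTree A) i≤)))

theorem4p3 : (n : ℕ) → 3 ≤ n → (A : Ordering n) →
    Σ (ℕ → Vec ℕ (suc n)) (λ f → Injective _≡_ _≡_ f ×
      ((i : ℕ) → Positive (f i) × UniquelyOptimal A (f i)))
theorem4p3 n _ A = instances , instances-injective , λ i → instances-positive i , instances-optimal i
  where
  t : Tree
  t = toTree A
  δ : ℕ → ℕ
  δ = proj₁ (uniqueMinimiser t)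
  N : ℕ → ℕ
  N i = suc (cost e₂ δ t + cost e₃ δ t + i)

  instances : ℕ → Vec ℕ (suc n)
  instances i = tabulate ((λ v → N i + δ v) ∘ toℕ)

  instances-injective : Injective _≡_ _≡_ instances
  instances-injective {i} {j} e = +-cancelˡ-≡ _ i j (suc-injective
    (+-cancelʳ-≡ (δ 0) (N i) (N j) (cong head e)))

  instances-positive : ∀ i → Positive (instances i)
  instances-positive i = tabulate⁺ λ j → s≤s (z≤n {cost e₂ δ t + cost e₃ δ t + i + δ (toℕ j)})

  instances-optimal : ∀ i → UniquelyOptimal A (instances i)
  instances-optimal i B B≢A = subst₂ _<_ (sym (T-tabulate _ A)) (sym (T-tabulate _ B))
    (offset-uniqueOptimal (N i) (proj₂ (uniqueMinimiser t)) (s≤s (m≤m+n _ i)) (toTree B)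
      (trans (size-toTree B) (sym (size-toTree A))) (B≢A ∘ toTree-injective B A))
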